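{- Let $H=(V,E)$ be an unweighted hypergraph. Suppose $\textsc{WeakEdges}(H',k)$ is any procedure that, given a hypergraph $H'$ and a number $k$, returns a subset of the edges of $H'$ containing every edge $e$ of $H'$ with $\gamma_{H'}(e)<k$. Run the following algorithm $\textsc{Estimation}(H)$: choose $k$ with $\gamma_H(e)\ge k$ for all $e\in E$; set $H_0=H$, $i=1$; while $H_{i-1}$ has edges, let $F_i=\textsc{WeakEdges}(H_{i-1},2^ik)$, set $\gamma'(e)=2^{i-1}k$ for every $e\in F_i$, set $H_i=H_{i-1}-F_i$ (delete the edges of $F_i$), and increase $i$ by $1$. Then: (1) for each $i$ and each $e\in F_i$, $\gamma_H(e)\ge 2^{i-1}k$; (2) for each $e\in E$, $\gamma'(e)\le\gamma_H(e)$.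
   Context: A hypergraph $H=(V,E)$ has finite vertex set $V$ and a (multi)set $E$ of edges, each a nonempty subset of $V$. For $U\subseteq V$, $H[U]=(U,\{e\in E:e\subseteq U\})$. For $A\subseteq V$, $\delta_H(A)=\{e\in E: e\cap A\ne\emptyset,\ e\cap (V\setminus A)\ne\emptyset\}$. $\lambda(H)=\min_{\emptyset\subsetneq A\subsetneq V}|\delta_H(A)|$ and the strength of $e$ is $\gamma_H(e)=\max_{e\subseteq U\subseteq V}\lambda(H[U])$. -}

module Defs where

open import Data.Nat using (ℕ; zero; suc; _+_; _*_; _^_; _≤_)
open import Data.Bool using (Bool; true; false)
open import Data.Fin using (Fin; cast)
open import Data.List.Properties using (length-map)
open import Relation.Binary.PropositionalEquality using (_≡_; sym)
import Data.Fin.Properties as FinP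
open import Data.Fin.Subset using (Subset; Nonempty; _⊆_; _⊂_; _∩_; _─_; ⊤)
open import Data.Fin.Subset.Properties using (nonempty?; _⊆?_)
open import Data.List using (List; []; _∷_; length; filter; map; lookup; allFin)
import Data.List.Membership.DecPropositional as DecMem
open import Data.Product using (Σ; ∃; _×_; _,_; proj₁; proj₂)
open import Data.Maybe using (Maybe; just; nothing)
open import Relation.Nullary using (¬_; yes; no)
open import Relation.Nullary.Decidable using (_×-dec_)

-- Hypergraphs on the vertex set V = Fin n.
-- The (multi)set of edges is a list of subsets of Fin n (edges are
-- identified by their position in the list, so repeated edges are allowed).

Hypergraph : ℕ → Set
Hypergraph n = List (Subset n)

WellFormed : ∀ {n} → Hypergraph n → Set
WellFormed H = ∀ j → Nonempty (lookup H j)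

-- H[U] : keep the edges contained in U (its vertex set is U)
induced : ∀ {n} → Subset n → Hypergraph n → Hypergraph n
induced U H = filter (λ e → e ⊆? U) H

δ : ∀ {n} → Subset n → Hypergraph n → Subset n → Hypergraph n
δ U E A = filter (λ e → nonempty? (e ∩ A) ×-dec nonempty? (e ∩ (U ─ A))) E

-- "λ((U,E)) ≥ k" : every cut ∅ ⊊ A ⊊ U has |δ(A)| ≥ k
-- (vacuous when U has fewer than two vertices, i.e. λ = ∞ there)
LambdaAtLeast : ∀ {n} → Subset n → Hypergraph n → ℕ → Set
LambdaAtLeast U E k = ∀ A → Nonempty A → A ⊂ U → k ≤ length (δ U E A)

StrengthAtLeast : ∀ {n} → Hypergraph n → Subset n → ℕ → Set
StrengthAtLeast {n} H e k = Σ (Subset n) λ U → e ⊆ U × LambdaAtLeast U (induced U H) k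

-- WeakEdges procedures: given H' and k, return a subset of the edges of H'
-- (as a selection of edge positions) containing every edge of strength < k.

WeakEdgesProc : ℕ → Set
WeakEdgesProc n = (H' : Hypergraph n) → ℕ → Fin (length H') → Bool

IsWeakEdges : ∀ {n} → WeakEdgesProc n → Set
IsWeakEdges {n} W = ∀ (H' : Hypergraph n) (k : ℕ) → WellFormed H' →
  ∀ j → ¬ StrengthAtLeast H' (lookup H' j) k → W H' k j ≡ true

split : ∀ {A : Set} (xs : List A) → (Fin (length xs) → Bool) → List A × List A
split []       s = [] , []
split (x ∷ xs) s with s Fin.zero | split xs (λ j → s (Fin.suc j))
... | true  | (ys , zs) = x ∷ ys , zs
... | false | (ys , zs) = ys , x ∷ zs

-- Edges of H are tracked by their index in Fin (length H).
-- alive i = edges of H_i ;  removed (suc i) = F_{i+1}.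
-- Once H_{i} has no edges, all further rounds are empty (no-ops), so
-- running for every i models the while loop.

module Estimation {n : ℕ} (H : Hypergraph n) (W : WeakEdgesProc n) (k : ℕ) where

  Idx : Set
  Idx = Fin (length H)

  edgesOf : List Idx → Hypergraph n
  edgesOf = map (lookup H)

  step : ℕ → List Idx → List Idx × List Idx
  step i as = split as (λ j → W (edgesOf as) (2 ^ i * k)
                                 (cast (sym (length-map (lookup H) as)) j))

  alive : ℕ → List Idx
  alive zero    = allFin (length H)
  alive (suc i) = proj₂ (step (suc i) (alive i))

  F : ℕ → List Idx
  F zero    = []
  F (suc i) = proj₁ (step (suc i) (alive i))

  -- γ' after r rounds (nothing = not yet assigned):
  -- in round i+1 every e ∈ F_{i+1} gets γ'(e) = 2^i k
  γ' : ℕ → Idx → Maybe ℕ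
  γ' zero    j = nothing
  γ' (suc r) j with DecMem._∈?_ FinP._≟_ j (F (suc r))
  ... | yes _ = just (2 ^ r * k)
  ... | no  _ = γ' r j

module Submission where

-- Strength is monotone under deleting edges: a cut of H'[U] with
-- H' ⊆ H is crossed by at most as many edges as the same cut of H[U].
-- Strength is also decidable (everything ranges over subsets of Fin n), so
-- the contrapositive of the WeakEdges specification holds constructively:
-- an edge of H' that WeakEdges(H', k) does NOT select has strength ≥ k in H'.
-- Hence every edge surviving round i+1 (kept in H_{i+1}) has strength
-- ≥ 2^{i+1} k in H_i ⊆ H, hence in H; together with the choice of k for
-- round 0, every edge of H_i has strength ≥ 2^i k in H.  Edges of F_{i+1}
-- are edges of H_i, which is claim (1), and γ' only ever records such
-- values 2^i k, which is claim (2).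

open import Defs
open import Data.Nat using (ℕ; zero; suc; _^_; _*_; _≤?_)
open import Data.Nat.Properties using (≤-trans; *-identityˡ)
open import Data.Bool using (true; false)
open import Data.Fin using (Fin; zero; suc; cast)
import Data.Fin.Properties as FinP
open import Data.Fin.Subset using (Subset; Nonempty)
open import Data.Fin.Subset.Properties using (anySubset?; nonempty?; _⊆?_; _⊂?_)
open import Data.List using (List; []; _∷_; length; lookup; map; filter; allFin)
open import Data.List.Properties using (map-tabulate; tabulate-lookup)
open import Data.List.Relation.Unary.Any using (here; there)
open import Data.List.Membership.Propositional using (_∈_)
open import Data.List.Membership.Propositional.Properties using (∈-lookup; ∈-map⁻)
import Data.List.Membership.DecPropositional as DecMem
open import Data.List.Relation.Binary.Sublist.Propositional using (_⊆_; []; _∷_; _∷ʳ_; ⊆-refl; ⊆-trans) renaming (lookup to ⊆-∈)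
open import Data.List.Relation.Binary.Sublist.Propositional.Properties using (map⁺; filter⁺; length-mono-≤)
open import Data.Maybe using (just)
open import Data.Product using (∃; _×_; _,_; proj₁; proj₂)
import Data.Product as Product
open import Function using (id)
open import Relation.Nullary using (Dec; yes; no; contradiction)
open import Relation.Nullary.Decidable using (_×-dec_; _→-dec_; ¬?; decidable-stable)
open import Relation.Binary.PropositionalEquality using (_≡_; refl; sym; trans; subst)

module _ {n : ℕ} where

  -- Deleting edges cannot increase strength: every cut of H'[U] is crossed
  -- by a sublist of the edges crossing the same cut of H[U].
  strength-mono : ∀ {H' H : Hypergraph n} → H' ⊆ H → ∀ {e k} →
    StrengthAtLeast H' e k → StrengthAtLeast H e k
  strength-mono H'⊆H (U , e⊆U , cuts) = U , e⊆U , λ A A≠∅ A⊂U →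
    ≤-trans (cuts A A≠∅ A⊂U) (length-mono-≤ (filter-mono (filter-mono H'⊆H)))
    where
    filter-mono : ∀ {P : Subset n → Set} {P? : ∀ e → Dec (P e)} {xs ys} →
      xs ⊆ ys → filter P? xs ⊆ filter P? ys
    filter-mono {P? = P?} = filter⁺ P? P? (λ { refl p → p })

  -- A universally quantified decidable property of subsets is decidable,
  -- since Subset n is finite: refute it by searching for a counterexample.
  allSubsets? : ∀ {P : Subset n → Set} → (∀ A → Dec (P A)) → Dec (∀ A → P A)
  allSubsets? P? with anySubset? (λ A → ¬? (P? A))
  ... | yes (A , ¬PA) = no λ ∀P → ¬PA (∀P A)
  ... | no ∄¬P        = yes λ A → decidable-stable (P? A) (λ ¬PA → ∄¬P (A , ¬PA))

  lambdaAtLeast? : ∀ U (E : Hypergraph n) k → Dec (LambdaAtLeast U E k)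
  lambdaAtLeast? U E k = allSubsets? λ A →
    nonempty? A →-dec ((A ⊂? U) →-dec (k ≤? length (δ U E A)))

  strengthAtLeast? : ∀ (H : Hypergraph n) e k → Dec (StrengthAtLeast H e k)
  strengthAtLeast? H e k = anySubset? λ U → (e ⊆? U) ×-dec lambdaAtLeast? U (induced U H) k

  unselected-strong : ∀ {W : WeakEdgesProc n} → IsWeakEdges W →
    ∀ {H' : Hypergraph n} {k} → WellFormed H' →
    ∀ j → W H' k j ≡ false → StrengthAtLeast H' (lookup H' j) k
  unselected-strong isWeak {H'} {k} wf j unselected
    with strengthAtLeast? H' (lookup H' j) k
  ... | yes strong = strong
  ... | no weak = contradiction (trans (sym unselected) (isWeak H' k wf j weak)) λ ()

module _ {A : Set} where

  split-selected-⊆ : ∀ (xs : List A) s → proj₁ (split xs s) ⊆ xs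
  split-selected-⊆ [] s = []
  split-selected-⊆ (x ∷ xs) s
    with s zero | split xs (λ j → s (suc j)) | split-selected-⊆ xs (λ j → s (suc j))
  ... | true  | _ | ys⊆xs = refl ∷ ys⊆xs
  ... | false | _ | ys⊆xs = x ∷ʳ ys⊆xs

  split-unselected-⊆ : ∀ (xs : List A) s → proj₂ (split xs s) ⊆ xs
  split-unselected-⊆ [] s = []
  split-unselected-⊆ (x ∷ xs) s
    with s zero | split xs (λ j → s (suc j)) | split-unselected-⊆ xs (λ j → s (suc j))
  ... | true  | _ | zs⊆xs = x ∷ʳ zs⊆xs
  ... | false | _ | zs⊆xs = refl ∷ zs⊆xs

  split-unselected-∈ : ∀ (xs : List A) s {x} → x ∈ proj₂ (split xs s) →
    ∃ λ p → lookup xs p ≡ x × s p ≡ false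
  split-unselected-∈ (y ∷ xs) s x∈zs
    with s zero in s₀ | split xs (λ j → s (suc j)) | split-unselected-∈ xs (λ j → s (suc j))
  ... | true  | _ | rest = Product.map suc id (rest x∈zs)
  ... | false | _ | rest with x∈zs
  ...   | here x≡y    = zero , sym x≡y , s₀
  ...   | there x∈zs′ = Product.map suc id (rest x∈zs′)

lookup-map-cast : ∀ {A B : Set} (f : A → B) (xs : List A) (p : Fin (length xs))
  .(eq : length xs ≡ length (map f xs)) → lookup (map f xs) (cast eq p) ≡ f (lookup xs p)
lookup-map-cast f (x ∷ xs) zero    eq = refl
lookup-map-cast f (x ∷ xs) (suc p) eq = lookup-map-cast f xs p _

module Soundness {n : ℕ} (H : Hypergraph n) (wf : WellFormed H)
                 (W : WeakEdgesProc n) (isWeak : IsWeakEdges W)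
                 (k : ℕ) (k-valid : ∀ j → StrengthAtLeast H (lookup H j) k) where

  open Estimation H W k

  alive-⊆ : ∀ i → alive i ⊆ allFin (length H)
  alive-⊆ zero    = ⊆-refl
  alive-⊆ (suc i) = ⊆-trans (split-unselected-⊆ _ _) (alive-⊆ i)

  edgesOf-alive-⊆ : ∀ i → edgesOf (alive i) ⊆ H
  edgesOf-alive-⊆ i = subst (edgesOf (alive i) ⊆_) edgesOf-allFin (map⁺ (lookup H) (alive-⊆ i))
    where
    edgesOf-allFin : edgesOf (allFin (length H)) ≡ H
    edgesOf-allFin = trans (map-tabulate id (lookup H)) (tabulate-lookup H)

  edgesOf-wellFormed : ∀ js → WellFormed (edgesOf js)
  edgesOf-wellFormed js q with ∈-map⁻ (lookup H) (∈-lookup {xs = edgesOf js} q)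
  ... | j , _ , edge≡ = subst Nonempty (sym edge≡) (wf j)

  -- An edge surviving round i+1 was not selected by WeakEdges(H_i, 2^{i+1} k),
  -- so it has strength ≥ 2^{i+1} k in H_i, hence in H.
  survivor-strong : ∀ i {j} → j ∈ alive (suc i) →
    StrengthAtLeast H (lookup H j) (2 ^ suc i * k)
  survivor-strong i j∈ with split-unselected-∈ (alive i) _ j∈
  ... | p , refl , unselected =
    subst (λ e → StrengthAtLeast H e (2 ^ suc i * k))
          (lookup-map-cast (lookup H) (alive i) p _)
          (strength-mono (edgesOf-alive-⊆ i)
            (unselected-strong isWeak (edgesOf-wellFormed (alive i)) _ unselected))

  alive-strong : ∀ i {j} → j ∈ alive i → StrengthAtLeast H (lookup H j) (2 ^ i * k)
  alive-strong zero    {j} _ = subst (StrengthAtLeast H (lookup H j)) (sym (*-identityˡ k)) (k-valid j)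
  alive-strong (suc i)     = survivor-strong i

  -- Claim (1): F_{i+1} ⊆ H_i, so its edges have strength ≥ 2^i k.
  removed-strong : ∀ i j → j ∈ F (suc i) → StrengthAtLeast H (lookup H j) (2 ^ i * k)
  removed-strong i j j∈F = alive-strong i (⊆-∈ (split-selected-⊆ _ _) j∈F)

  γ'-sound : ∀ r j v → γ' r j ≡ just v → StrengthAtLeast H (lookup H j) v
  γ'-sound zero    j v ()
  γ'-sound (suc r) j v assigned with DecMem._∈?_ FinP._≟_ j (F (suc r))
  γ'-sound (suc r) j v refl     | yes j∈F = removed-strong r j j∈F
  γ'-sound (suc r) j v assigned | no _    = γ'-sound r j v assigned

lemma11 : ∀ {n} (H : Hypergraph n) → WellFormed H →
    (W : WeakEdgesProc n) → IsWeakEdges W →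
    (k : ℕ) → (∀ j → StrengthAtLeast H (lookup H j) k) →
    let open Estimation H W k in
    (∀ (i : ℕ) (j : Fin (length H)) → j ∈ F (suc i) →
        StrengthAtLeast H (lookup H j) (2 ^ i * k))
    × (∀ (r : ℕ) (j : Fin (length H)) (v : ℕ) → γ' r j ≡ just v →
        StrengthAtLeast H (lookup H j) v)
lemma11 H wf W isWeak k k-valid = removed-strong , γ'-sound
  where open Soundness H wf W isWeak k k-valid
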